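{- For all integers $n\ge2$, $$\sum_{\pi\in\mathfrak{S}_n^1}t^{\mathsf{des}(\pi)}s^{\mathsf{asc}(\pi)}=\sum_{\pi\in\mathfrak{S}_n^{n-1}}t^{\mathsf{exc}(\pi)}s^{\mathsf{nexc}(\pi)-1}.$$
   Context: $\mathfrak{S}_n$ is the symmetric group on $[n]$; for $1\le i\le n$, $\mathfrak{S}_n^i=\{\pi\in\mathfrak{S}_n:\pi_i=n\}$. For $\pi\in\mathfrak{S}_n$: $\mathsf{des}(\pi)=|\{i\in[n-1]:\pi_i>\pi_{i+1}\}|$, $\mathsf{asc}(\pi)=|\{i\in[n-1]:\pi_i<\pi_{i+1}\}|$, $\mathsf{exc}(\pi)=|\{i:\pi_i>i\}|$, $\mathsf{nexc}(\pi)=|\{i:\pi_i\le i\}|$. -}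

module Defs where

open import Level using (Level)
open import Data.Nat using (ℕ; zero; suc; _∸_; _<_; _≤_; _<ᵇ_; _≤ᵇ_; _≡ᵇ_; _≟_)
open import Data.Bool using (Bool; true; false; if_then_else_)
open import Data.List using (List; []; _∷_; map; concatMap; filter; foldr; length)
open import Data.List.Relation.Unary.Unique.DecPropositional _≟_ using (unique?)
open import Relation.Nullary.Decidable using (does)
open import Algebra.Bundles using (CommutativeSemiring)
import Algebra.Definitions.RawSemiring as RS

-- Permutations of [n] are represented in one-line notation as lists
-- π = [π₁, …, πₙ] of natural numbers (1-based values and positions).

range : ℕ → List ℕ
range zero = []
range (suc n) = range n Data.List.++ (suc n ∷ [])

words : ℕ → ℕ → List (List ℕ)
words n zero = [] ∷ []
words n (suc k) = concatMap (λ a → map (a ∷_) (words n k)) (range n)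

Sym : ℕ → List (List ℕ)
Sym n = filter unique? (words n n)

-- πᵢ (1-based); 0 if out of range
at : List ℕ → ℕ → ℕ
at [] _ = 0
at (x ∷ xs) zero = 0
at (x ∷ xs) (suc zero) = x
at (x ∷ xs) (suc (suc i)) = at xs (suc i)

SymAt : ℕ → ℕ → List (List ℕ)
SymAt n i = filter (λ π → at π i ≟ n) (Sym n)

count : Bool → ℕ
count true = 1
count false = 0

des : List ℕ → ℕ
des [] = 0
des (x ∷ []) = 0
des (x ∷ y ∷ ys) = count (y <ᵇ x) Data.Nat.+ des (y ∷ ys)

asc : List ℕ → ℕ
asc [] = 0
asc (x ∷ []) = 0
asc (x ∷ y ∷ ys) = count (x <ᵇ y) Data.Nat.+ asc (y ∷ ys)

excFrom : ℕ → List ℕ → ℕ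
excFrom i [] = 0
excFrom i (x ∷ xs) = count (i <ᵇ x) Data.Nat.+ excFrom (suc i) xs

nexcFrom : ℕ → List ℕ → ℕ
nexcFrom i [] = 0
nexcFrom i (x ∷ xs) = count (x ≤ᵇ i) Data.Nat.+ nexcFrom (suc i) xs

exc : List ℕ → ℕ
exc = excFrom 1

nexc : List ℕ → ℕ
nexc = nexcFrom 1

module _ {c ℓ : Level} (R : CommutativeSemiring c ℓ) where
  open CommutativeSemiring R
  sumOver : List (List ℕ) → (List ℕ → Carrier) → Carrier
  sumOver L f = foldr (λ π acc → f π + acc) 0# L

  pow : Carrier → ℕ → Carrier
  pow = RS._^_ rawSemiring

module Submission where

-- For n = k + 1 ≥ 2 we have 𝔖ₙ¹ = {n σ : σ ∈ 𝔖ₖ} and 𝔖ₙⁿ⁻¹ = {σ₁ … σₖ₋₁ n σₖ : σ ∈ 𝔖ₖ}.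
-- Prepending n adds one descent and no ascent, inserting n before the last entry adds
-- one excedance, and des + asc = k − 1, exc + nexc = k + 1.  Hence both sides equal
-- Σ_{σ ∈ 𝔖ₖ} t^{1 + d σ} s^{k − 1 − d σ}, with d = des on the left and d = exc on the right,
-- and it remains to show that des and exc are equidistributed on 𝔖ₖ.  For this, 𝔖ₖ₊₁ is
-- built from 𝔖ₖ in two ways by inserting k + 1: linearly (at each position) and cyclically
-- (as a fixed point, or after some i in its cycle).  Under linear insertion des, and under
-- cyclic insertion exc, spreads a value d into the values d^{d+1} (d+1)^{k−d}, so both
-- statistics obey the Eulerian recursion and induction on k concludes.

open import Defs
open import Level using (Level)
open import Data.Nat using (ℕ; _≤_; _∸_)
open import Algebra.Bundles using (CommutativeSemiring)

open import Data.Nat using (zero; suc; _+_; _<_; z≤n; s≤s; s≤s⁻¹; _<ᵇ_; _≤ᵇ_; _≟_)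
open import Data.Bool using (true; false)
open import Data.Empty using (⊥-elim)
open import Data.List
  using (List; []; _∷_; _++_; _∷ʳ_; [_]; map; concatMap; filter; foldr; length; replicate; initLast; _∷ʳ′_)
open import Data.List.Membership.DecPropositional _≟_ using (_∈?_)
open import Data.List.Membership.Propositional using (_∈_; _∉_; find; lose)
open import Data.List.Membership.Propositional.Properties
  using (∈-++⁺ˡ; ∈-++⁺ʳ; ∈-++⁻; ∈-∃++; ∈-map⁺; ∈-map⁻; ∈-concatMap⁺; ∈-concatMap⁻; ∈-filter⁺; ∈-filter⁻)
open import Data.List.Membership.Propositional.Properties.WithK using (unique∧set⇒bag)
open import Data.List.Properties
  using ( ∷-injective; ∷ʳ-injective; map-++; map-replicate; map-id; map-∘; map-cong; map-cong-local
        ; map-concatMap; concatMap-map; concatMap-pure; foldr-map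
        ; filter-++; filter-all; filter-none; filter-accept; filter-reject)
open import Data.List.Relation.Binary.BagAndSetEquality using (∼bag⇒↭)
open import Data.List.Relation.Binary.Permutation.Propositional
  using (_↭_; ↭-refl; ↭-sym; ↭-trans; ↭-reflexive; ↭⇒↭ₛ; ↭⇒↭ₛ′; module PermutationReasoning)
import Data.List.Relation.Binary.Permutation.Propositional as ↭
open import Data.List.Relation.Binary.Permutation.Propositional.Properties
  using (shift; shifts; ++⁺ˡ; ++⁺; ↭-length; All-resp-↭; ∷↭∷ʳ; map⁺; filter-↭)
import Data.List.Relation.Binary.Permutation.Setoid.Properties as Permₛ
open import Data.List.Relation.Unary.All as All using (All; []; _∷_)
open import Data.List.Relation.Unary.All.Properties using (All¬⇒¬Any; ¬Any⇒All¬)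
open import Data.List.Relation.Unary.Any using (here; there)
open import Data.List.Relation.Unary.Unique.DecPropositional _≟_ using (unique?)
open import Data.List.Relation.Unary.Unique.Propositional using (Unique; []; _∷_)
import Data.List.Relation.Unary.Unique.Propositional.Properties as Unique
open import Data.Nat.Properties
  using ( ≤-refl; ≤-trans; <-irrefl; <-cmp; <⇒≤; n≤1+n; m≤n⇒m≤1+n; m≤n⇒m<n∨m≡n; m≤m+n; suc-injective
        ; +-comm; +-suc; +-identityʳ; +-∸-assoc; ∸-+-assoc; m+n∸m≡n; +-commutativeSemigroup)
open import Algebra.Properties.CommutativeSemigroup +-commutativeSemigroup
  using () renaming (interchange to +-interchange)
open import Data.Product using (∃; ∃₂; _×_; _,_; proj₁; proj₂; map₁)
open import Data.Sum using (inj₁; inj₂)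
open import Function using (_∘_)
open import Function.Bundles using (_⇔_; mk⇔)
open import Relation.Binary.Definitions using (tri<; tri≈; tri>)
open import Relation.Binary.PropositionalEquality
  using (_≡_; _≢_; refl; sym; trans; cong; cong₂; subst; module ≡-Reasoning)
  renaming (setoid to ≡-setoid)
import Relation.Binary.Reasoning.Setoid as SetoidReasoning
open import Relation.Nullary using (¬_; Dec; does; yes; no; ¬?)

private variable
  A B : Set

unique-same-elements⇒↭ : {xs ys : List A} → Unique xs → Unique ys →
  (∀ {z} → z ∈ xs ⇔ z ∈ ys) → xs ↭ ys
unique-same-elements⇒↭ uxs uys same = ∼bag⇒↭ (unique∧set⇒bag uxs uys same)

unique-resp-↭ : {xs ys : List A} → xs ↭ ys → Unique xs → Unique ys
unique-resp-↭ {A = A} p = Permₛ.Unique-resp-↭ (≡-setoid A) (↭⇒↭ₛ p)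

concatMap-unique : (f : A → List B) {L : List A} → Unique L →
  (∀ {a} → a ∈ L → Unique (f a)) →
  (∀ {a a′ z} → a ∈ L → a′ ∈ L → z ∈ f a → z ∈ f a′ → a ≡ a′) →
  Unique (concatMap f L)
concatMap-unique f {[]} _ _ _ = []
concatMap-unique f {a ∷ L} (a∉L ∷ uL) uf separated =
  Unique.++⁺ (uf (here refl))
    (concatMap-unique f uL (uf ∘ there) (λ p q → separated (there p) (there q)))
    disjoint
  where
  disjoint : ∀ {z} → ¬ (z ∈ f a × z ∈ concatMap f L)
  disjoint (z∈fa , z∈rest) with find (∈-concatMap⁻ f {xs = L} z∈rest)
  ... | a′ , a′∈L , z∈fa′ = All.lookup a∉L a′∈L (separated (here refl) (there a′∈L) z∈fa z∈fa′)

concatMap-↭ : (f : A → List B) {xs ys : List A} → xs ↭ ys → concatMap f xs ↭ concatMap f ys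
concatMap-↭ f ↭.refl = ↭-refl
concatMap-↭ f (↭.prep x p) = ++⁺ˡ (f x) (concatMap-↭ f p)
concatMap-↭ f (↭.swap x y p) = ↭-trans (shifts (f x) (f y)) (++⁺ˡ (f y) (++⁺ˡ (f x) (concatMap-↭ f p)))
concatMap-↭ f (↭.trans p q) = ↭-trans (concatMap-↭ f p) (concatMap-↭ f q)

concatMap-cong-↭ : (f g : A → List B) (L : List A) → (∀ {a} → a ∈ L → f a ↭ g a) →
  concatMap f L ↭ concatMap g L
concatMap-cong-↭ f g [] _ = ↭-refl
concatMap-cong-↭ f g (a ∷ L) f↭g = ++⁺ (f↭g (here refl)) (concatMap-cong-↭ f g L (f↭g ∘ there))

filter-concatMap : {P : B → Set} (P? : (b : B) → Dec (P b)) (f : A → List B) (L : List A) →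
  filter P? (concatMap f L) ≡ concatMap (filter P? ∘ f) L
filter-concatMap P? f [] = refl
filter-concatMap P? f (a ∷ L) =
  trans (filter-++ P? (f a) (concatMap f L)) (cong (filter P? (f a) ++_) (filter-concatMap P? f L))

filter-map : {P : B → Set} (P? : (b : B) → Dec (P b)) (f : A → B) (L : List A) →
  filter P? (map f L) ≡ map f (filter (P? ∘ f) L)
filter-map P? f [] = refl
filter-map P? f (a ∷ L) with does (P? (f a))
... | true = cong (f a ∷_) (filter-map P? f L)
... | false = filter-map P? f L

InRange : ℕ → ℕ → Set
InRange n x = 1 ≤ x × x ≤ n

IsPerm : ℕ → List ℕ → Set
IsPerm n π = length π ≡ n × All (InRange n) π × Unique π

widen : ∀ {k x} → InRange k x → InRange (suc k) x
widen (1≤x , x≤k) = 1≤x , m≤n⇒m≤1+n x≤k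

narrow : ∀ {k xs} → All (InRange (suc k)) xs → suc k ∉ xs → All (InRange k) xs
narrow {k} bounded k+1∉ = All.tabulate λ x∈ → below (All.lookup bounded x∈) (λ { refl → k+1∉ x∈ })
  where
  below : ∀ {x} → InRange (suc k) x → x ≢ suc k → InRange k x
  below (1≤x , x≤k+1) x≢k+1 with m≤n⇒m<n∨m≡n x≤k+1
  ... | inj₁ x<k+1 = 1≤x , s≤s⁻¹ x<k+1
  ... | inj₂ x≡k+1 = ⊥-elim (x≢k+1 x≡k+1)

max∉ : ∀ {k xs} → All (InRange k) xs → suc k ∉ xs
max∉ bounded k+1∈ = <-irrefl refl (proj₂ (All.lookup bounded k+1∈))

∈-range⁻ : ∀ n {x} → x ∈ range n → InRange n x
∈-range⁻ (suc n) x∈ with ∈-++⁻ (range n) x∈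
... | inj₁ x∈range = widen (∈-range⁻ n x∈range)
... | inj₂ (here refl) = s≤s z≤n , ≤-refl

∈-range⁺ : ∀ n {x} → InRange n x → x ∈ range n
∈-range⁺ zero (1≤x , x≤0) with ≤-trans 1≤x x≤0
... | ()
∈-range⁺ (suc n) (1≤x , x≤n+1) with m≤n⇒m<n∨m≡n x≤n+1
... | inj₁ x<n+1 = ∈-++⁺ˡ (∈-range⁺ n (1≤x , s≤s⁻¹ x<n+1))
... | inj₂ refl = ∈-++⁺ʳ (range n) (here refl)

range-unique : ∀ n → Unique (range n)
range-unique zero = []
range-unique (suc n) =
  Unique.++⁺ (range-unique n) ([] ∷ []) λ { (x∈ , here refl) → max∉ (All.tabulate (∈-range⁻ n)) x∈ }

∈-words⁻ : ∀ n k {π} → π ∈ words n k → length π ≡ k × All (InRange n) π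
∈-words⁻ n zero (here refl) = refl , []
∈-words⁻ n (suc k) π∈ with find (∈-concatMap⁻ (λ a → map (a ∷_) (words n k)) {xs = range n} π∈)
... | a , a∈ , π∈a∷ with ∈-map⁻ (a ∷_) π∈a∷
... | τ , τ∈ , refl with ∈-words⁻ n k τ∈
... | len , bounded = cong suc len , ∈-range⁻ n a∈ ∷ bounded

∈-words⁺ : ∀ n {π} → All (InRange n) π → π ∈ words n (length π)
∈-words⁺ n [] = here refl
∈-words⁺ n {a ∷ π} (a∈[n] ∷ bounded) =
  ∈-concatMap⁺ (λ b → map (b ∷_) (words n (length π)))
    (lose (∈-range⁺ n a∈[n]) (∈-map⁺ (a ∷_) (∈-words⁺ n bounded)))

words-unique : ∀ n k → Unique (words n k)
words-unique n zero = [] ∷ []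
words-unique n (suc k) =
  concatMap-unique (λ a → map (a ∷_) (words n k)) (range-unique n)
    (λ _ → Unique.map⁺ (proj₂ ∘ ∷-injective) (words-unique n k)) same-head
  where
  same-head : ∀ {a a′ z} → a ∈ range n → a′ ∈ range n →
    z ∈ map (a ∷_) (words n k) → z ∈ map (a′ ∷_) (words n k) → a ≡ a′
  same-head _ _ z∈ z∈′ with ∈-map⁻ _ z∈ | ∈-map⁻ _ z∈′
  ... | _ , _ , refl | _ , _ , refl = refl

∈-Sym⁻ : ∀ n {π} → π ∈ Sym n → IsPerm n π
∈-Sym⁻ n π∈ with ∈-filter⁻ unique? π∈
... | π∈words , u with ∈-words⁻ n n π∈words
... | len , bounded = len , bounded , u

∈-Sym⁺ : ∀ n {π} → IsPerm n π → π ∈ Sym n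
∈-Sym⁺ n (refl , bounded , u) = ∈-filter⁺ unique? (∈-words⁺ n bounded) u

Sym-unique : ∀ n → Unique (Sym n)
Sym-unique n = Unique.filter⁺ unique? (words-unique n n)

unique-bounded-length : ∀ k {xs} → Unique xs → All (InRange k) xs → length xs ≤ k
unique-bounded-length zero {[]} _ _ = z≤n
unique-bounded-length zero {x ∷ _} _ ((1≤x , x≤0) ∷ _) with ≤-trans 1≤x x≤0
... | ()
unique-bounded-length (suc k) {xs} u bounded with suc k ∈? xs
... | no k+1∉ = m≤n⇒m≤1+n (unique-bounded-length k u (narrow bounded k+1∉))
... | yes k+1∈ with ∈-∃++ k+1∈
... | α , β , refl with unique-resp-↭ (shift (suc k) α β) u | All-resp-↭ (shift (suc k) α β) bounded
... | k+1∉ ∷ u′ | _ ∷ bounded′ =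
  subst (_≤ suc k) (sym (↭-length (shift (suc k) α β)))
    (s≤s (unique-bounded-length k u′ (narrow bounded′ (All¬⇒¬Any k+1∉))))

max∈ : ∀ k {π} → IsPerm (suc k) π → suc k ∈ π
max∈ k {π} (len , bounded , u) with suc k ∈? π
... | yes k+1∈ = k+1∈
... | no k+1∉ = ⊥-elim (<-irrefl refl (subst (_≤ k) len (unique-bounded-length k u (narrow bounded k+1∉))))

IsPerm-insert : ∀ k {σ τ} → τ ↭ suc k ∷ σ → IsPerm k σ → IsPerm (suc k) τ
IsPerm-insert k p (len , bounded , u) =
  trans (↭-length p) (cong suc len) ,
  All-resp-↭ (↭-sym p) ((s≤s z≤n , ≤-refl) ∷ All.map widen bounded) ,
  unique-resp-↭ (↭-sym p) (¬Any⇒All¬ _ (max∉ bounded) ∷ u)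

IsPerm-remove : ∀ k {σ τ} → τ ↭ suc k ∷ σ → IsPerm (suc k) τ → IsPerm k σ
IsPerm-remove k p (len , bounded , u) with All-resp-↭ p bounded | unique-resp-↭ p u
... | _ ∷ bounded′ | k+1∉ ∷ u′ =
  suc-injective (trans (sym (↭-length p)) len) , narrow bounded′ (All¬⇒¬Any k+1∉) , u′

record InsertionScheme : Set where
  field
    insert           : ℕ → List ℕ → List (List ℕ)
    insert-↭         : ∀ m σ {τ} → τ ∈ insert m σ → τ ↭ m ∷ σ
    insert-unique    : ∀ m σ → m ∉ σ → Unique (insert m σ)
    insert-injective : ∀ m {σ σ′ τ} → m ∉ σ → m ∉ σ′ → τ ∈ insert m σ → τ ∈ insert m σ′ → σ ≡ σ′
    insert-onto      : ∀ m {τ} → m ∈ τ → ∃ λ σ → τ ∈ insert m σ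

Sym-by-insertion : (S : InsertionScheme) → ∀ k →
  Sym (suc k) ↭ concatMap (InsertionScheme.insert S (suc k)) (Sym k)
Sym-by-insertion S k =
  unique-same-elements⇒↭ (Sym-unique (suc k))
    (concatMap-unique (insert (suc k)) (Sym-unique k)
      (λ σ∈ → insert-unique (suc k) _ (fresh σ∈))
      (λ σ∈ σ′∈ → insert-injective (suc k) (fresh σ∈) (fresh σ′∈)))
    (mk⇔ obtained perm)
  where
  open InsertionScheme S
  fresh : ∀ {σ} → σ ∈ Sym k → suc k ∉ σ
  fresh σ∈ = max∉ (proj₁ (proj₂ (∈-Sym⁻ k σ∈)))
  obtained : ∀ {π} → π ∈ Sym (suc k) → π ∈ concatMap (insert (suc k)) (Sym k)
  obtained π∈ with insert-onto (suc k) (max∈ k (∈-Sym⁻ (suc k) π∈))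
  ... | σ , π∈ins = ∈-concatMap⁺ (insert (suc k))
    (lose (∈-Sym⁺ k (IsPerm-remove k (insert-↭ (suc k) σ π∈ins) (∈-Sym⁻ (suc k) π∈))) π∈ins)
  perm : ∀ {π} → π ∈ concatMap (insert (suc k)) (Sym k) → π ∈ Sym (suc k)
  perm π∈ with find (∈-concatMap⁻ (insert (suc k)) {xs = Sym k} π∈)
  ... | σ , σ∈ , π∈ins = ∈-Sym⁺ (suc k) (IsPerm-insert k (insert-↭ (suc k) σ π∈ins) (∈-Sym⁻ k σ∈))

linIns : ℕ → List ℕ → List (List ℕ)
linIns m [] = [ [ m ] ]
linIns m (x ∷ σ) = (m ∷ x ∷ σ) ∷ map (x ∷_) (linIns m σ)

linIns-↭ : ∀ m σ {τ} → τ ∈ linIns m σ → τ ↭ m ∷ σ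
linIns-↭ m [] (here refl) = ↭-refl
linIns-↭ m (x ∷ σ) (here refl) = ↭-refl
linIns-↭ m (x ∷ σ) (there τ∈) with ∈-map⁻ (x ∷_) τ∈
... | τ′ , τ′∈ , refl = ↭-trans (↭.prep x (linIns-↭ m σ τ′∈)) (↭.swap x m ↭-refl)

linIns-unique : ∀ m σ → m ∉ σ → Unique (linIns m σ)
linIns-unique m [] _ = [] ∷ []
linIns-unique m (x ∷ σ) m∉ =
  ¬Any⇒All¬ _ m-first-only ∷ Unique.map⁺ (proj₂ ∘ ∷-injective) (linIns-unique m σ (m∉ ∘ there))
  where
  m-first-only : (m ∷ x ∷ σ) ∉ map (x ∷_) (linIns m σ)
  m-first-only τ∈ with ∈-map⁻ (x ∷_) τ∈
  ... | _ , _ , eq = m∉ (here (proj₁ (∷-injective eq)))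

deleteAll : ℕ → List ℕ → List ℕ
deleteAll m = filter (λ x → ¬? (x ≟ m))

deleteAll-fresh : ∀ m σ → m ∉ σ → deleteAll m σ ≡ σ
deleteAll-fresh m σ m∉ = filter-all (λ x → ¬? (x ≟ m)) (All.tabulate λ { x∈ refl → m∉ x∈ })

deleteAll-linIns : ∀ m σ {τ} → m ∉ σ → τ ∈ linIns m σ → deleteAll m τ ≡ σ
deleteAll-linIns m [] _ (here refl) = filter-reject (λ x → ¬? (x ≟ m)) (λ m≢m → m≢m refl)
deleteAll-linIns m (x ∷ σ) m∉ (here refl) =
  trans (filter-reject (λ y → ¬? (y ≟ m)) (λ m≢m → m≢m refl)) (deleteAll-fresh m (x ∷ σ) m∉)
deleteAll-linIns m (x ∷ σ) m∉ (there τ∈) with ∈-map⁻ (x ∷_) τ∈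
... | τ′ , τ′∈ , refl =
  trans (filter-accept (λ y → ¬? (y ≟ m)) (λ { refl → m∉ (here refl) }))
    (cong (x ∷_) (deleteAll-linIns m σ (m∉ ∘ there) τ′∈))

linIns-split : ∀ m α β → α ++ m ∷ β ∈ linIns m (α ++ β)
linIns-split m [] [] = here refl
linIns-split m [] (x ∷ β) = here refl
linIns-split m (a ∷ α) β = there (∈-map⁺ (a ∷_) (linIns-split m α β))

linear : InsertionScheme
linear = record
  { insert           = linIns
  ; insert-↭         = linIns-↭
  ; insert-unique    = linIns-unique
  ; insert-injective = λ m {σ} {σ′} m∉σ m∉σ′ τ∈ τ∈′ →
      trans (sym (deleteAll-linIns m σ m∉σ τ∈)) (deleteAll-linIns m σ′ m∉σ′ τ∈′)
  ; insert-onto      = λ m m∈ → onto (∈-∃++ m∈)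
  }
  where
  onto : ∀ {m τ} → ∃₂ (λ α β → τ ≡ α ++ [ m ] ++ β) → ∃ λ σ → τ ∈ linIns m σ
  onto {m} (α , β , refl) = α ++ β , linIns-split m α β

exchanges : ℕ → List ℕ → List (List ℕ × ℕ)
exchanges m [] = []
exchanges m (x ∷ σ) = (m ∷ σ , x) ∷ map (map₁ (x ∷_)) (exchanges m σ)

cycPairs : ℕ → List ℕ → List (List ℕ × ℕ)
cycPairs m σ = (σ , m) ∷ exchanges m σ

appendLast : List ℕ × ℕ → List ℕ
appendLast (ρ , y) = ρ ∷ʳ y

-- Cyclic insertion: viewing σ as a permutation of [k] and m = suc k, the length σ + 1 ways of
-- adding m to the cycle structure: as a new fixed point, or right after some i in its cycle.
cycIns : ℕ → List ℕ → List (List ℕ)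
cycIns m σ = map appendLast (cycPairs m σ)

exchange-↭ : ∀ m σ {ρ y} → (ρ , y) ∈ exchanges m σ → y ∷ ρ ↭ m ∷ σ
exchange-↭ m (x ∷ σ) (here refl) = ↭.swap x m ↭-refl
exchange-↭ m (x ∷ σ) (there p∈) with ∈-map⁻ (map₁ (x ∷_)) p∈
... | (ρ , y) , p′∈ , refl =
  ↭-trans (↭.swap y x ↭-refl) (↭-trans (↭.prep x (exchange-↭ m σ p′∈)) (↭.swap x m ↭-refl))

exchange-length : ∀ m σ {ρ y} → (ρ , y) ∈ exchanges m σ → length ρ ≡ length σ
exchange-length m σ p∈ = suc-injective (↭-length (exchange-↭ m σ p∈))

exchange-value∈ : ∀ m σ {ρ y} → (ρ , y) ∈ exchanges m σ → y ∈ σ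
exchange-value∈ m (x ∷ σ) (here refl) = here refl
exchange-value∈ m (x ∷ σ) (there p∈) with ∈-map⁻ (map₁ (x ∷_)) p∈
... | _ , p′∈ , refl = there (exchange-value∈ m σ p′∈)

cycIns-↭ : ∀ m σ {τ} → τ ∈ cycIns m σ → τ ↭ m ∷ σ
cycIns-↭ m σ τ∈ with ∈-map⁻ appendLast τ∈
... | (ρ , y) , p∈ , refl = ↭-trans (↭-sym (∷↭∷ʳ y ρ)) (pair-↭ p∈)
  where
  pair-↭ : ∀ {ρ y} → (ρ , y) ∈ cycPairs m σ → y ∷ ρ ↭ m ∷ σ
  pair-↭ (here refl) = ↭-refl
  pair-↭ (there p∈) = exchange-↭ m σ p∈

exchanges-unique : ∀ m σ → m ∉ σ → Unique (exchanges m σ)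
exchanges-unique m [] _ = []
exchanges-unique m (x ∷ σ) m∉ =
  ¬Any⇒All¬ _ m-first-only ∷ Unique.map⁺ tail-injective (exchanges-unique m σ (m∉ ∘ there))
  where
  m-first-only : (m ∷ σ , x) ∉ map (map₁ (x ∷_)) (exchanges m σ)
  m-first-only p∈ with ∈-map⁻ (map₁ (x ∷_)) p∈
  ... | _ , _ , eq = m∉ (here (proj₁ (∷-injective (cong proj₁ eq))))
  tail-injective : ∀ {p q : List ℕ × ℕ} → map₁ (x ∷_) p ≡ map₁ (x ∷_) q → p ≡ q
  tail-injective {_ , _} {_ , _} refl = refl

cycIns-unique : ∀ m σ → m ∉ σ → Unique (cycIns m σ)
cycIns-unique m σ m∉ =
  Unique.map⁺ appendLast-injective
    (¬Any⇒All¬ _ (λ p∈ → m∉ (exchange-value∈ m σ p∈)) ∷ exchanges-unique m σ m∉)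
  where
  appendLast-injective : ∀ {p q} → appendLast p ≡ appendLast q → p ≡ q
  appendLast-injective {ρ , y} {ρ′ , y′} eq with ∷ʳ-injective ρ ρ′ eq
  ... | refl , refl = refl

replace : ℕ → ℕ → List ℕ → List ℕ
replace m y [] = []
replace m y (x ∷ ρ) with x ≟ m
... | yes _ = y ∷ replace m y ρ
... | no _ = x ∷ replace m y ρ

replace-fresh : ∀ m y σ → m ∉ σ → replace m y σ ≡ σ
replace-fresh m y [] _ = refl
replace-fresh m y (x ∷ σ) m∉ with x ≟ m
... | yes refl = ⊥-elim (m∉ (here refl))
... | no _ = cong (x ∷_) (replace-fresh m y σ (m∉ ∘ there))

replace-exchange : ∀ m σ {ρ y} → m ∉ σ → (ρ , y) ∈ exchanges m σ → replace m y ρ ≡ σ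
replace-exchange m (x ∷ σ) m∉ (here refl) with m ≟ m
... | yes _ = cong (x ∷_) (replace-fresh m x σ (m∉ ∘ there))
... | no m≢m = ⊥-elim (m≢m refl)
replace-exchange m (x ∷ σ) m∉ (there p∈) with ∈-map⁻ (map₁ (x ∷_)) p∈
... | (ρ , y) , p′∈ , refl with x ≟ m
...   | yes refl = ⊥-elim (m∉ (here refl))
...   | no _ = cong (x ∷_) (replace-exchange m σ (m∉ ∘ there) p′∈)

replace-cycPair : ∀ m σ {ρ y} → m ∉ σ → (ρ , y) ∈ cycPairs m σ → replace m y ρ ≡ σ
replace-cycPair m σ m∉ (here refl) = replace-fresh m m σ m∉
replace-cycPair m σ m∉ (there p∈) = replace-exchange m σ m∉ p∈

cycIns-injective : ∀ m {σ σ′ τ} → m ∉ σ → m ∉ σ′ → τ ∈ cycIns m σ → τ ∈ cycIns m σ′ → σ ≡ σ′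
cycIns-injective m {σ} {σ′} m∉σ m∉σ′ τ∈ τ∈′ with ∈-map⁻ appendLast τ∈ | ∈-map⁻ appendLast τ∈′
... | (ρ , y) , p∈ , refl | (ρ′ , y′) , p∈′ , eq with ∷ʳ-injective ρ ρ′ eq
...   | refl , refl = trans (sym (replace-cycPair m σ m∉σ p∈)) (replace-cycPair m σ′ m∉σ′ p∈′)

exchange-split : ∀ m α y β → (α ++ m ∷ β , y) ∈ exchanges m (α ++ y ∷ β)
exchange-split m [] y β = here refl
exchange-split m (a ∷ α) y β = there (∈-map⁺ (map₁ (a ∷_)) (exchange-split m α y β))

-- A list containing m ends in m, or in some y with m earlier.
cycIns-onto : ∀ m {τ} → m ∈ τ → ∃ λ σ → τ ∈ cycIns m σ
cycIns-onto m {τ} m∈ with initLast τ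
cycIns-onto m () | []
cycIns-onto m m∈ | ρ ∷ʳ′ y with y ≟ m | ∈-++⁻ ρ m∈
... | yes refl | _ = ρ , here refl
... | no y≢m | inj₂ (here refl) = ⊥-elim (y≢m refl)
... | no _ | inj₁ m∈ρ with ∈-∃++ m∈ρ
...   | α , β , refl = α ++ y ∷ β , ∈-map⁺ appendLast (there (exchange-split m α y β))

cyclic : InsertionScheme
cyclic = record
  { insert           = cycIns
  ; insert-↭         = cycIns-↭
  ; insert-unique    = cycIns-unique
  ; insert-injective = cycIns-injective
  ; insert-onto      = cycIns-onto
  }

-- If a permutation of [L] has
-- d descents (or d excedances), then over its L + 1 insertions of L + 1 this statistic
-- takes the values d ∷ row d L: this is the recursion of the Eulerian numbers.
row : ℕ → ℕ → List ℕ
row d L = replicate d d ++ replicate (L ∸ d) (suc d)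

row-step : ∀ b d L → d ≤ L → suc d ∷ map (count b +_) (row d L) ↭ row (count b + d) (suc L)
row-step true d L _ = ↭-reflexive (cong (suc d ∷_) (begin
  map suc (replicate d d ++ replicate (L ∸ d) (suc d))
    ≡⟨ map-++ suc (replicate d d) _ ⟩
  map suc (replicate d d) ++ map suc (replicate (L ∸ d) (suc d))
    ≡⟨ cong₂ _++_ (map-replicate suc d d) (map-replicate suc (L ∸ d) (suc d)) ⟩
  replicate d (suc d) ++ replicate (L ∸ d) (suc (suc d)) ∎))
  where open ≡-Reasoning
row-step false d L d≤L = begin
  suc d ∷ map (0 +_) (row d L)
    ≡⟨ cong (suc d ∷_) (map-id (row d L)) ⟩
  suc d ∷ replicate d d ++ replicate (L ∸ d) (suc d)
    ↭⟨ shift (suc d) (replicate d d) _ ⟨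
  replicate d d ++ replicate (suc (L ∸ d)) (suc d)
    ≡⟨ cong (λ l → replicate d d ++ replicate l (suc d)) (+-∸-assoc 1 d≤L) ⟨
  row d (suc L) ∎
  where open PermutationReasoning

count-< : ∀ {x y} → x < y → count (x <ᵇ y) ≡ 1
count-< {zero} {suc y} _ = refl
count-< {suc x} {suc y} (s≤s x<y) = count-< x<y

count-≮ : ∀ {x y} → y ≤ x → count (x <ᵇ y) ≡ 0
count-≮ {x} {zero} _ = refl
count-≮ {suc x} {suc y} (s≤s y≤x) = count-≮ y≤x

des-bound : ∀ x σ → des (x ∷ σ) ≤ length σ
des-bound x [] = z≤n
des-bound x (y ∷ σ) with y <ᵇ x
... | true = s≤s (des-bound y σ)
... | false = m≤n⇒m≤1+n (des-bound y σ)

des-0∷ : ∀ τ → des (0 ∷ τ) ≡ des τ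
des-0∷ [] = refl
des-0∷ (y ∷ τ) = refl

-- Descents over the linear insertions of m into σ, behind a fixed first entry x ≤ m,
-- follow the Eulerian recursion (m itself creates exactly one new descent, unless at the end).
des-linIns : ∀ m x σ → x ≤ m → All (_< m) σ →
  map (λ τ → des (x ∷ τ)) (linIns m σ) ↭ des (x ∷ σ) ∷ row (des (x ∷ σ)) (length σ)
des-linIns m x [] x≤m [] rewrite count-≮ x≤m = ↭-refl
des-linIns m x (y ∷ σ) x≤m (y<m ∷ σ<m) = begin
  des (x ∷ m ∷ y ∷ σ) ∷ map (λ τ → des (x ∷ τ)) (map (y ∷_) (linIns m σ))
    ≡⟨ cong₂ _∷_ m-adds-descent (trans (sym (map-∘ _)) (map-∘ _)) ⟩
  suc d ∷ map (b +_) (map (λ τ → des (y ∷ τ)) (linIns m σ))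
    ↭⟨ ↭.prep (suc d) (map⁺ (b +_) (des-linIns m y σ (≤-trans (n≤1+n y) y<m) σ<m)) ⟩
  suc d ∷ b + d ∷ map (b +_) (row d (length σ))
    ↭⟨ ↭.swap (suc d) (b + d) ↭-refl ⟩
  b + d ∷ suc d ∷ map (b +_) (row d (length σ))
    ↭⟨ ↭.prep (b + d) (row-step (y <ᵇ x) d (length σ) (des-bound y σ)) ⟩
  b + d ∷ row (b + d) (suc (length σ)) ∎
  where
  open PermutationReasoning
  b = count (y <ᵇ x)
  d = des (y ∷ σ)
  m-adds-descent : des (x ∷ m ∷ y ∷ σ) ≡ suc d
  m-adds-descent rewrite count-≮ x≤m | count-< y<m = refl

des-linIns-max : ∀ m σ → All (_< m) σ → map des (linIns m σ) ↭ des σ ∷ row (des σ) (length σ)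
des-linIns-max m σ σ<m = begin
  map des (linIns m σ)                        ≡⟨ map-cong (sym ∘ des-0∷) (linIns m σ) ⟩
  map (λ τ → des (0 ∷ τ)) (linIns m σ)        ↭⟨ des-linIns m 0 σ z≤n σ<m ⟩
  des (0 ∷ σ) ∷ row (des (0 ∷ σ)) (length σ)  ≡⟨ cong (λ d → d ∷ row d (length σ)) (des-0∷ σ) ⟩
  des σ ∷ row (des σ) (length σ)              ∎
  where open PermutationReasoning

excFrom-bound : ∀ i σ → excFrom i σ ≤ length σ
excFrom-bound i [] = z≤n
excFrom-bound i (x ∷ σ) with i <ᵇ x
... | true = s≤s (excFrom-bound (suc i) σ)
... | false = m≤n⇒m≤1+n (excFrom-bound (suc i) σ)

excFrom-∷ʳ : ∀ i ρ y → y ≤ i + length ρ → excFrom i (ρ ∷ʳ y) ≡ excFrom i ρ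
excFrom-∷ʳ i [] y y≤i rewrite count-≮ (subst (y ≤_) (+-identityʳ i) y≤i) = refl
excFrom-∷ʳ i (x ∷ ρ) y y≤ =
  cong (count (i <ᵇ x) +_) (excFrom-∷ʳ (suc i) ρ y (subst (y ≤_) (+-suc i (length ρ)) y≤))

-- Excedances (counted from position i) of the exchanges of m into σ follow the Eulerian
-- recursion, provided m exceeds every position: m itself is always an excedance.
excFrom-exchanges : ∀ m i σ → i + length σ ≤ m →
  map (excFrom i ∘ proj₁) (exchanges m σ) ↭ row (excFrom i σ) (length σ)
excFrom-exchanges m i [] _ = ↭-refl
excFrom-exchanges m i (x ∷ σ) fits = begin
  excFrom i (m ∷ σ) ∷ map (excFrom i ∘ proj₁) (map (map₁ (x ∷_)) (exchanges m σ))
    ≡⟨ cong₂ _∷_ m-is-excedance (trans (sym (map-∘ _)) (map-∘ _)) ⟩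
  suc e ∷ map (b +_) (map (excFrom (suc i) ∘ proj₁) (exchanges m σ))
    ↭⟨ ↭.prep (suc e) (map⁺ (b +_) (excFrom-exchanges m (suc i) σ fits′)) ⟩
  suc e ∷ map (b +_) (row e (length σ))
    ↭⟨ row-step (i <ᵇ x) e (length σ) (excFrom-bound (suc i) σ) ⟩
  row (b + e) (suc (length σ)) ∎
  where
  open PermutationReasoning
  b = count (i <ᵇ x)
  e = excFrom (suc i) σ
  fits′ : suc i + length σ ≤ m
  fits′ = subst (_≤ m) (+-suc i (length σ)) fits
  m-is-excedance : excFrom i (m ∷ σ) ≡ suc e
  m-is-excedance rewrite count-< (≤-trans (s≤s (m≤m+n i (length σ))) fits′) = refl

exc-cycIns : ∀ k σ → IsPerm k σ → map exc (cycIns (suc k) σ) ↭ exc σ ∷ row (exc σ) k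
exc-cycIns k σ (refl , bounded , _) = begin
  exc (σ ∷ʳ suc k) ∷ map exc (map appendLast (exchanges (suc k) σ))
    ≡⟨ cong₂ _∷_ (excFrom-∷ʳ 1 σ (suc k) ≤-refl)
                 (trans (sym (map-∘ _)) (map-cong-local (All.tabulate last-not-excedance))) ⟩
  exc σ ∷ map (exc ∘ proj₁) (exchanges (suc k) σ)
    ↭⟨ ↭.prep (exc σ) (excFrom-exchanges (suc k) 1 σ ≤-refl) ⟩
  exc σ ∷ row (exc σ) k ∎
  where
  open PermutationReasoning
  last-not-excedance : ∀ {p} → p ∈ exchanges (suc k) σ → exc (appendLast p) ≡ exc (proj₁ p)
  last-not-excedance {ρ , y} p∈ =
    excFrom-∷ʳ 1 ρ y (m≤n⇒m≤1+n (subst (y ≤_) (sym (exchange-length (suc k) σ p∈))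
      (proj₂ (All.lookup bounded (exchange-value∈ (suc k) σ p∈)))))

distribution-step : (S : InsertionScheme) (f : List ℕ → ℕ) → ∀ k →
  (∀ σ → IsPerm k σ → map f (InsertionScheme.insert S (suc k) σ) ↭ f σ ∷ row (f σ) k) →
  map f (Sym (suc k)) ↭ concatMap (λ d → d ∷ row d k) (map f (Sym k))
distribution-step S f k spreads = begin
  map f (Sym (suc k))                            ↭⟨ map⁺ f (Sym-by-insertion S k) ⟩
  map f (concatMap (insert (suc k)) (Sym k))     ≡⟨ map-concatMap f (insert (suc k)) (Sym k) ⟩
  concatMap (map f ∘ insert (suc k)) (Sym k)     ↭⟨ concatMap-cong-↭ _ _ (Sym k) (λ σ∈ → spreads _ (∈-Sym⁻ k σ∈)) ⟩
  concatMap (λ σ → f σ ∷ row (f σ) k) (Sym k)    ≡⟨ concatMap-map (λ d → d ∷ row d k) f (Sym k) ⟨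
  concatMap (λ d → d ∷ row d k) (map f (Sym k))  ∎
  where
  open PermutationReasoning
  open InsertionScheme S using (insert)

-- Descents and excedances are equidistributed on 𝔖_k: both follow the Eulerian recursion.
des-exc-equidistributed : ∀ k → map des (Sym k) ↭ map exc (Sym k)
des-exc-equidistributed zero = ↭-refl
des-exc-equidistributed (suc k) = begin
  map des (Sym (suc k))                            ↭⟨ distribution-step linear des k des-spreads ⟩
  concatMap (λ d → d ∷ row d k) (map des (Sym k))  ↭⟨ concatMap-↭ _ (des-exc-equidistributed k) ⟩
  concatMap (λ d → d ∷ row d k) (map exc (Sym k))  ↭⟨ distribution-step cyclic exc k (exc-cycIns k) ⟨
  map exc (Sym (suc k))                            ∎
  where
  open PermutationReasoning
  des-spreads : ∀ σ → IsPerm k σ → map des (linIns (suc k) σ) ↭ des σ ∷ row (des σ) k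
  des-spreads σ (refl , bounded , _) = des-linIns-max (suc (length σ)) σ (All.map (s≤s ∘ proj₂) bounded)

restricted-insertion : (S : InsertionScheme) {P : List ℕ → Set} (P? : (π : List ℕ) → Dec (P π))
  (g : List ℕ → List ℕ) → ∀ k →
  (∀ σ → IsPerm k σ → filter P? (InsertionScheme.insert S (suc k) σ) ≡ [ g σ ]) →
  filter P? (Sym (suc k)) ↭ map g (Sym k)
restricted-insertion S P? g k selects = begin
  filter P? (Sym (suc k))                         ↭⟨ filter-↭ P? (Sym-by-insertion S k) ⟩
  filter P? (concatMap (insert (suc k)) (Sym k))  ≡⟨ filter-concatMap P? (insert (suc k)) (Sym k) ⟩
  concatMap (filter P? ∘ insert (suc k)) (Sym k)  ↭⟨ concatMap-cong-↭ _ _ (Sym k) selects′ ⟩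
  concatMap ([_] ∘ g) (Sym k)                     ≡⟨ concatMap-map [_] g (Sym k) ⟨
  concatMap [_] (map g (Sym k))                   ≡⟨ concatMap-pure (map g (Sym k)) ⟩
  map g (Sym k)                                   ∎
  where
  open PermutationReasoning
  open InsertionScheme S using (insert)
  selects′ : ∀ {σ} → σ ∈ Sym k → filter P? (insert (suc k) σ) ↭ [ g σ ]
  selects′ σ∈ = ↭-reflexive (selects _ (∈-Sym⁻ k σ∈))

linIns-first : ∀ m σ → m ∉ σ → filter (λ π → at π 1 ≟ m) (linIns m σ) ≡ [ m ∷ σ ]
linIns-first m [] _ = filter-accept (λ π → at π 1 ≟ m) refl
linIns-first m (x ∷ σ) m∉ =
  trans (filter-accept (λ π → at π 1 ≟ m) refl)
    (cong ((m ∷ x ∷ σ) ∷_) (filter-none (λ π → at π 1 ≟ m) (All.tabulate starts-with-x)))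
  where
  starts-with-x : ∀ {τ} → τ ∈ map (x ∷_) (linIns m σ) → ¬ at τ 1 ≡ m
  starts-with-x τ∈ with ∈-map⁻ (x ∷_) τ∈
  ... | _ , _ , refl = λ { refl → m∉ (here refl) }

SymAt-first : ∀ k → SymAt (suc k) 1 ↭ map (suc k ∷_) (Sym k)
SymAt-first k = restricted-insertion linear (λ π → at π 1 ≟ suc k) (suc k ∷_) k
  (λ σ (_ , bounded , _) → linIns-first (suc k) σ (max∉ bounded))

beforeLast : ℕ → List ℕ → List ℕ
beforeLast m [] = [ m ]
beforeLast m (x ∷ []) = m ∷ x ∷ []
beforeLast m (x ∷ y ∷ σ) = x ∷ beforeLast m (y ∷ σ)

at-∷ʳ-∈ : ∀ x σ z → at ((x ∷ σ) ∷ʳ z) (suc (length σ)) ∈ x ∷ σ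
at-∷ʳ-∈ x [] z = here refl
at-∷ʳ-∈ x (y ∷ σ) z = there (at-∷ʳ-∈ y σ z)

exchanges-penultimate : ∀ m x σ → m ∉ x ∷ σ →
  filter (λ π → at π (suc (length σ)) ≟ m) (map appendLast (exchanges m (x ∷ σ))) ≡ [ beforeLast m (x ∷ σ) ]
exchanges-penultimate m x [] _ = filter-accept (λ π → at π 1 ≟ m) refl
exchanges-penultimate m x (y ∷ σ) m∉ = begin
  filter (P (suc (suc (length σ)))) (appendLast (m ∷ y ∷ σ , x) ∷ map appendLast (map (map₁ (x ∷_)) E))
    ≡⟨ filter-reject (P (suc (suc (length σ)))) {x = appendLast (m ∷ y ∷ σ , x)} m-not-last ⟩
  filter (P (suc (suc (length σ)))) (map appendLast (map (map₁ (x ∷_)) E))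
    ≡⟨ cong (filter (P (suc (suc (length σ))))) cons-commutes ⟩
  filter (P (suc (suc (length σ)))) (map (x ∷_) (map appendLast E))
    ≡⟨ filter-map (P (suc (suc (length σ)))) (x ∷_) (map appendLast E) ⟩
  map (x ∷_) (filter (P (suc (length σ))) (map appendLast E))
    ≡⟨ cong (map (x ∷_)) (exchanges-penultimate m y σ (m∉ ∘ there)) ⟩
  [ beforeLast m (x ∷ y ∷ σ) ] ∎
  where
  open ≡-Reasoning
  E = exchanges m (y ∷ σ)
  P : ∀ i (π : List ℕ) → Dec (at π i ≡ m)
  P i π = at π i ≟ m
  cons-commutes : map appendLast (map (map₁ (x ∷_)) E) ≡ map (x ∷_) (map appendLast E)
  cons-commutes = trans (sym (map-∘ {g = appendLast} {f = map₁ (x ∷_)} E)) (map-∘ {g = x ∷_} {f = appendLast} E)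
  m-not-last : ¬ at (appendLast (m ∷ y ∷ σ , x)) (suc (suc (length σ))) ≡ m
  m-not-last eq = m∉ (there (subst (_∈ y ∷ σ) eq (at-∷ʳ-∈ y σ x)))

-- Among the cyclic insertions of m into x ∷ σ (m ∉ x ∷ σ), only beforeLast m (x ∷ σ) has m
-- at position length (x ∷ σ): appending m as a fixed point leaves an entry of x ∷ σ there.
cycIns-penultimate : ∀ m x σ → m ∉ x ∷ σ →
  filter (λ π → at π (suc (length σ)) ≟ m) (cycIns m (x ∷ σ)) ≡ [ beforeLast m (x ∷ σ) ]
cycIns-penultimate m x σ m∉ =
  trans (filter-reject (λ π → at π (suc (length σ)) ≟ m) {x = (x ∷ σ) ∷ʳ m} m-not-last)
    (exchanges-penultimate m x σ m∉)
  where
  m-not-last : ¬ at ((x ∷ σ) ∷ʳ m) (suc (length σ)) ≡ m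
  m-not-last eq = m∉ (subst (_∈ x ∷ σ) eq (at-∷ʳ-∈ x σ m))

SymAt-penultimate : ∀ j → SymAt (suc (suc j)) (suc j) ↭ map (beforeLast (suc (suc j))) (Sym (suc j))
SymAt-penultimate j =
  restricted-insertion cyclic (λ π → at π (suc j) ≟ suc (suc j)) (beforeLast (suc (suc j))) (suc j) selects
  where
  selects : ∀ σ → IsPerm (suc j) σ →
    filter (λ π → at π (suc j) ≟ suc (suc j)) (cycIns (suc (suc j)) σ) ≡ [ beforeLast (suc (suc j)) σ ]
  selects (x ∷ σ) (refl , bounded , _) = cycIns-penultimate _ x σ (max∉ bounded)

descent-or-ascent : ∀ {x y} → x ≢ y → count (y <ᵇ x) + count (x <ᵇ y) ≡ 1
descent-or-ascent {x} {y} x≢y with <-cmp x y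
... | tri< x<y _ _ rewrite count-≮ (<⇒≤ x<y) | count-< x<y = refl
... | tri≈ _ x≡y _ = ⊥-elim (x≢y x≡y)
... | tri> _ _ y<x rewrite count-< y<x | count-≮ (<⇒≤ y<x) = refl

des+asc : ∀ x σ → Unique (x ∷ σ) → des (x ∷ σ) + asc (x ∷ σ) ≡ length σ
des+asc x [] _ = refl
des+asc x (y ∷ σ) ((x≢y ∷ _) ∷ u) = begin
  (count (y <ᵇ x) + des (y ∷ σ)) + (count (x <ᵇ y) + asc (y ∷ σ))
    ≡⟨ +-interchange (count (y <ᵇ x)) (des (y ∷ σ)) (count (x <ᵇ y)) (asc (y ∷ σ)) ⟩
  (count (y <ᵇ x) + count (x <ᵇ y)) + (des (y ∷ σ) + asc (y ∷ σ))
    ≡⟨ cong₂ _+_ (descent-or-ascent x≢y) (des+asc y σ u) ⟩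
  suc (length σ) ∎
  where open ≡-Reasoning

excedance-or-not : ∀ i x → count (i <ᵇ x) + count (x ≤ᵇ i) ≡ 1
excedance-or-not i zero = refl
excedance-or-not zero (suc x) = refl
excedance-or-not (suc i) (suc zero) = excedance-or-not i zero
excedance-or-not (suc i) (suc (suc x)) = excedance-or-not i (suc x)

exc+nexc : ∀ i σ → excFrom i σ + nexcFrom i σ ≡ length σ
exc+nexc i [] = refl
exc+nexc i (x ∷ σ) = begin
  (count (i <ᵇ x) + excFrom (suc i) σ) + (count (x ≤ᵇ i) + nexcFrom (suc i) σ)
    ≡⟨ +-interchange (count (i <ᵇ x)) (excFrom (suc i) σ) (count (x ≤ᵇ i)) (nexcFrom (suc i) σ) ⟩
  (count (i <ᵇ x) + count (x ≤ᵇ i)) + (excFrom (suc i) σ + nexcFrom (suc i) σ)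
    ≡⟨ cong₂ _+_ (excedance-or-not i x) (exc+nexc (suc i) σ) ⟩
  suc (length σ) ∎
  where open ≡-Reasoning

first-stats : ∀ j σ → IsPerm (suc j) σ →
  (des (suc (suc j) ∷ σ) , asc (suc (suc j) ∷ σ)) ≡ (suc (des σ) , j ∸ des σ)
first-stats j (x ∷ σ) (refl , (_ , x≤) ∷ _ , u) =
  cong₂ _,_ (cong (_+ des (x ∷ σ)) (count-< (s≤s x≤)))
    (trans (cong (_+ asc (x ∷ σ)) (count-≮ (m≤n⇒m≤1+n x≤)))
      (sym (trans (cong (_∸ des (x ∷ σ)) (sym (des+asc x σ u))) (m+n∸m≡n (des (x ∷ σ)) _))))

beforeLast-length : ∀ m x σ → length (beforeLast m (x ∷ σ)) ≡ suc (suc (length σ))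
beforeLast-length m x [] = refl
beforeLast-length m x (y ∷ σ) = cong suc (beforeLast-length m y σ)

excFrom-beforeLast : ∀ m i x σ → All (_≤ i + length σ) (x ∷ σ) → i + length σ < m →
  excFrom i (beforeLast m (x ∷ σ)) ≡ suc (excFrom i (x ∷ σ))
excFrom-beforeLast m i x [] (x≤ ∷ []) fits
  rewrite +-identityʳ i | count-< fits | count-≮ (m≤n⇒m≤1+n x≤) | count-≮ x≤ = refl
excFrom-beforeLast m i x (y ∷ σ) (_ ∷ bounded) fits =
  trans (cong (count (i <ᵇ x) +_) (excFrom-beforeLast m (suc i) y σ bounded′ fits′)) (+-suc _ _)
  where
  bounded′ : All (_≤ suc i + length σ) (y ∷ σ)
  bounded′ = All.map (λ {z} z≤ → subst (z ≤_) (+-suc i (length σ)) z≤) bounded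
  fits′ : suc i + length σ < m
  fits′ = subst (_< m) (+-suc i (length σ)) fits

-- Inserting the maximum n just before the last entry of σ ∈ 𝔖ₙ₋₁ adds one excedance;
-- as nexc = length − exc, the exponent nexc − 1 becomes n − 2 − exc σ.
penultimate-stats : ∀ j σ → IsPerm (suc j) σ →
  (exc (beforeLast (suc (suc j)) σ) , nexc (beforeLast (suc (suc j)) σ) ∸ 1) ≡ (suc (exc σ) , j ∸ exc σ)
penultimate-stats j (x ∷ σ) (refl , bounded , _) = cong₂ _,_ exc-π (begin
  nexc π ∸ 1                       ≡⟨ cong (_∸ 1) (sym (m+n∸m≡n (exc π) (nexc π))) ⟩
  (exc π + nexc π) ∸ exc π ∸ 1     ≡⟨ cong (λ l → l ∸ exc π ∸ 1) (trans (exc+nexc 1 π) (beforeLast-length n x σ)) ⟩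
  suc (suc j) ∸ exc π ∸ 1          ≡⟨ cong (λ e → suc (suc j) ∸ e ∸ 1) exc-π ⟩
  suc j ∸ exc (x ∷ σ) ∸ 1          ≡⟨ ∸-+-assoc (suc j) (exc (x ∷ σ)) 1 ⟩
  suc j ∸ (exc (x ∷ σ) + 1)        ≡⟨ cong (suc j ∸_) (+-comm (exc (x ∷ σ)) 1) ⟩
  j ∸ exc (x ∷ σ)                  ∎)
  where
  open ≡-Reasoning
  n = suc (suc j)
  π = beforeLast n (x ∷ σ)
  exc-π : exc π ≡ suc (exc (x ∷ σ))
  exc-π = excFrom-beforeLast n 1 x σ (All.map proj₂ bounded) ≤-refl

-- The joint distribution of (des, asc) on 𝔖ₙ¹ equals that of (exc, nexc − 1) on 𝔖ₙ^{n−1}: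
-- both are that of (1 + d, n − 2 − d) for d the descent (equivalently excedance) number on 𝔖ₙ₋₁.
joint-distribution : ∀ j →
  map (λ π → des π , asc π) (SymAt (suc (suc j)) 1) ↭
  map (λ π → exc π , nexc π ∸ 1) (SymAt (suc (suc j)) (suc j))
joint-distribution j = begin
  map stat₁ (SymAt n 1)                   ↭⟨ map⁺ stat₁ (SymAt-first k) ⟩
  map stat₁ (map (n ∷_) (Sym k))          ≡⟨ trans (sym (map-∘ _)) (map-cong-local (All.tabulate first)) ⟩
  map (shape ∘ des) (Sym k)               ≡⟨ map-∘ _ ⟩
  map shape (map des (Sym k))             ↭⟨ map⁺ shape (des-exc-equidistributed k) ⟩
  map shape (map exc (Sym k))             ≡⟨ map-∘ _ ⟨
  map (shape ∘ exc) (Sym k)               ≡⟨ trans (sym (map-∘ _)) (map-cong-local (All.tabulate penultimate)) ⟨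
  map stat₂ (map (beforeLast n) (Sym k))  ↭⟨ map⁺ stat₂ (SymAt-penultimate j) ⟨
  map stat₂ (SymAt n k)                   ∎
  where
  open PermutationReasoning
  k = suc j
  n = suc k
  stat₁ stat₂ : List ℕ → ℕ × ℕ
  stat₁ π = des π , asc π
  stat₂ π = exc π , nexc π ∸ 1
  shape : ℕ → ℕ × ℕ
  shape d = suc d , j ∸ d
  first : ∀ {σ} → σ ∈ Sym k → stat₁ (n ∷ σ) ≡ shape (des σ)
  first {σ} σ∈ = first-stats j σ (∈-Sym⁻ k σ∈)
  penultimate : ∀ {σ} → σ ∈ Sym k → stat₂ (beforeLast n σ) ≡ shape (exc σ)
  penultimate {σ} σ∈ = penultimate-stats j σ (∈-Sym⁻ k σ∈)

sumOver-↭ : {c ℓ : Level} (R : CommutativeSemiring c ℓ) {L L′ : List (List ℕ)}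
  (f g : List ℕ → CommutativeSemiring.Carrier R) → map f L ↭ map g L′ →
  CommutativeSemiring._≈_ R (sumOver R L f) (sumOver R L′ g)
sumOver-↭ R {L} {L′} f g f↭g = begin
  sumOver R L f          ≡⟨ foldr-map _⊕_ f 𝟘 L ⟨
  foldr _⊕_ 𝟘 (map f L)   ≈⟨ Permₛ.foldr-commMonoid setoid +-isCommutativeMonoid (↭⇒↭ₛ′ isEquivalence f↭g) ⟩
  foldr _⊕_ 𝟘 (map g L′)  ≡⟨ foldr-map _⊕_ g 𝟘 L′ ⟩
  sumOver R L′ g          ∎
  where
  open CommutativeSemiring R using (setoid; isEquivalence; +-isCommutativeMonoid)
    renaming (_+_ to _⊕_; 0# to 𝟘)
  open SetoidReasoning setoid

lemma10 : {c ℓ : Level} (R : CommutativeSemiring c ℓ) (t s : CommutativeSemiring.Carrier R)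
    (n : ℕ) → 2 ≤ n →
    CommutativeSemiring._≈_ R
      (sumOver R (SymAt n 1) (λ π → CommutativeSemiring._*_ R (pow R t (des π)) (pow R s (asc π))))
      (sumOver R (SymAt n (n ∸ 1)) (λ π → CommutativeSemiring._*_ R (pow R t (exc π)) (pow R s (nexc π ∸ 1))))
lemma10 R t s (suc (suc j)) (s≤s (s≤s z≤n)) = sumOver-↭ R _ _ (begin
  map (weight ∘ stat₁) (SymAt n 1)      ≡⟨ map-∘ _ ⟩
  map weight (map stat₁ (SymAt n 1))    ↭⟨ map⁺ weight (joint-distribution j) ⟩
  map weight (map stat₂ (SymAt n k))    ≡⟨ map-∘ _ ⟨
  map (weight ∘ stat₂) (SymAt n k)      ∎)
  where
  open PermutationReasoning
  open CommutativeSemiring R using (Carrier; _*_)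
  k = suc j
  n = suc k
  stat₁ stat₂ : List ℕ → ℕ × ℕ
  stat₁ π = des π , asc π
  stat₂ π = exc π , nexc π ∸ 1
  weight : ℕ × ℕ → Carrier
  weight (a , b) = pow R t a * pow R s b
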